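{- Assume $|A|\ge 2$. Then for all closed terms $P$ and $Q$ over $\Sigma_{CP}(A)$: if $P=_{cr}Q$ then $\mathrm{CP}_{cr}\vdash P=Q$.
   Context: Fix a finite non-empty set $A$ of atomic propositions. Closed terms are built from $T$, $F$, $a\in A$ by conditional composition $P\triangleleft Q\triangleright R$. $\mathrm{CP}_{cr}$ consists of (CP1) $x\triangleleft T\triangleright y=x$, (CP2) $x\triangleleft F\triangleright y=y$, (CP3) $T\triangleleft x\triangleright F=x$, (CP4) $x\triangleleft(y\triangleleft z\triangleright u)\triangleright v=(x\triangleleft y\triangleright v)\triangleleft z\triangleright(x\triangleleft u\triangleright v)$, and for every $a\in A$: (CPcr1) $(x\triangleleft a\triangleright y)\triangleleft a\triangleright z=x\triangleleft a\triangleright z$, (CPcr2) $x\triangleleft a\triangleright(y\triangleleft a\triangleright z)=x\triangleleft a\triangleright z$; $\vdash$ is equational derivability. A reactive valuation algebra (RVA) is a set $RV$ with elements $T_{RV},F_{RV}$ and for each $a\in A$ functions $y_a:RV\to\{T,F\}$, $\partial_a:RV\to RV$ with $y_a(T_{RV})=T$, $y_a(F_{RV})=F$, $\partial_a(T_{RV})=T_{RV}$, $\partial_a(F_{RV})=F_{RV}$. For closed $P$ and $H\in RV$: $T/H=T$, $F/H=F$, $a/H=y_a(H)$, $\partial_T(H)=\partial_F(H)=H$; $(P\triangleleft Q\triangleright R)/H=P/\partial_Q(H)$ and $\partial_{P\triangleleft Q\triangleright R}(H)=\partial_P(\partial_Q(H))$ if $Q/H=T$, and $R/\partial_Q(H)$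 resp. $\partial_R(\partial_Q(H))$ if $Q/H=F$. The variety $cr$ is the class of RVAs with $y_a(\partial_a(H))=y_a(H)$ and $\partial_a(\partial_a(H))=\partial_a(H)$ for all $a$, $H$. $P\equiv_{cr}Q$ means $P/H=Q/H$ for all RVAs in $cr$ and all $H$; $=_{cr}$ is the largest congruence (w.r.t. conditional composition) on closed terms contained in $\equiv_{cr}$. -}

module Defs where

open import Data.Nat using (ℕ)
open import Data.Fin using (Fin)
open import Data.Bool using (Bool; true; false; if_then_else_)
open import Data.Product using (Σ; _×_)
open import Level using (Level; suc; zero)
open import Relation.Binary.PropositionalEquality using (_≡_)

-- The finite non-empty set A of atomic propositions is Fin n (|A| = n).

data Term (n : ℕ) : Set where
  T F : Term n
  atom : Fin n → Term n
  _◁_▷_ : Term n → Term n → Term n → Term n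

infix 5 _◁_▷_

data Axiom {n : ℕ} : Term n → Term n → Set where
  CP1 : ∀ x y → Axiom (x ◁ T ▷ y) x
  CP2 : ∀ x y → Axiom (x ◁ F ▷ y) y
  CP3 : ∀ x → Axiom (T ◁ x ▷ F) x
  CP4 : ∀ x y z u v →
    Axiom (x ◁ (y ◁ z ▷ u) ▷ v) ((x ◁ y ▷ v) ◁ z ▷ (x ◁ u ▷ v))
  CPcr1 : ∀ a x y z →
    Axiom ((x ◁ atom a ▷ y) ◁ atom a ▷ z) (x ◁ atom a ▷ z)
  CPcr2 : ∀ a x y z →
    Axiom (x ◁ atom a ▷ (y ◁ atom a ▷ z)) (x ◁ atom a ▷ z)

data _⊢CPcr_≈_ (n : ℕ) : Term n → Term n → Set where
  ax    : ∀ {P Q} → Axiom P Q → n ⊢CPcr P ≈ Q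
  refl  : ∀ {P} → n ⊢CPcr P ≈ P
  sym   : ∀ {P Q} → n ⊢CPcr P ≈ Q → n ⊢CPcr Q ≈ P
  trans : ∀ {P Q R} → n ⊢CPcr P ≈ Q → n ⊢CPcr Q ≈ R → n ⊢CPcr P ≈ R
  cong  : ∀ {P P' Q Q' R R'} → n ⊢CPcr P ≈ P' → n ⊢CPcr Q ≈ Q' →
          n ⊢CPcr R ≈ R' → n ⊢CPcr (P ◁ Q ▷ R) ≈ (P' ◁ Q' ▷ R')

record RVA (n : ℕ) : Set₁ where
  field
    RV   : Set
    T-RV : RV
    F-RV : RV
    y    : Fin n → RV → Bool
    ∂    : Fin n → RV → RV
    y-T  : ∀ a → y a T-RV ≡ true
    y-F  : ∀ a → y a F-RV ≡ false
    ∂-T  : ∀ a → ∂ a T-RV ≡ T-RV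
    ∂-F  : ∀ a → ∂ a F-RV ≡ F-RV

module _ {n : ℕ} (V : RVA n) where
  open RVA V

  mutual
    _/_ : Term n → RV → Bool
    T / H = true
    F / H = false
    atom a / H = y a H
    (P ◁ Q ▷ R) / H = if Q / H then P / ∂T Q H else R / ∂T Q H

    ∂T : Term n → RV → RV
    ∂T T H = H
    ∂T F H = H
    ∂T (atom a) H = ∂ a H
    ∂T (P ◁ Q ▷ R) H = if Q / H then ∂T P (∂T Q H) else ∂T R (∂T Q H)

record InCr {n : ℕ} (V : RVA n) : Set where
  open RVA V
  field
    y-∂ : ∀ a H → y a (∂ a H) ≡ y a H
    ∂-∂ : ∀ a H → ∂ a (∂ a H) ≡ ∂ a H

_≡cr_ : {n : ℕ} → Term n → Term n → Set₁
_≡cr_ {n} P Q = (V : RVA n) → InCr V → (H : RVA.RV V) → _/_ V P H ≡ _/_ V Q H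

record IsCongruence {n : ℕ} (R : Term n → Term n → Set₁) : Set₁ where
  field
    reflexive  : ∀ {P} → R P P
    symmetric  : ∀ {P Q} → R P Q → R Q P
    transitive : ∀ {P Q S} → R P Q → R Q S → R P S
    compatible : ∀ {P P' Q Q' S S'} → R P P' → R Q Q' → R S S' →
                 R (P ◁ Q ▷ S) (P' ◁ Q' ▷ S')

-- P =_cr Q : (P,Q) lies in the largest congruence contained in ≡_cr,
-- i.e. in some congruence contained in ≡_cr.
_=cr_ : {n : ℕ} → Term n → Term n → Set₂
_=cr_ {n} P Q = Σ (Term n → Term n → Set₁) λ R →
  IsCongruence R × (∀ {P' Q'} → R P' Q' → P' ≡cr Q') × R P Q

module Submission where

-- Every closed term is CP_cr-derivably equal to a basic form in which no atom is queried
-- twice in a row: CP4 pushes conditions towards the leaves and CPcr1/CPcr2 delete repeated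
-- queries. It remains to separate distinct basic forms by =_cr. In the cr-algebras whose
-- states are histories of answered queries, a fresh query being answered by an arbitrary
-- oracle on the history, a basic form makes a fresh query at each node, so its run records
-- the path taken. The contexts K_e ◁ _ ▷ K_e, where K_e queries an atom other than e (this
-- needs |A| ≥ 2) and then e, let the oracle inspect that record: this exposes the root atom,
-- and prescribing the oracle's answer at the root's depth descends into either branch.

open import Defs
open import Data.Nat using (ℕ; _≤_; _<_; suc; z≤n; s≤s) renaming (_≟_ to _≟ℕ_)
open import Data.Nat.Properties using (≤-refl; ≤-trans; m≤n+m; <⇒≢; <⇒≤)
open import Data.Fin using (Fin) renaming (zero to fzero; suc to fsuc; _≟_ to _≟F_)
open import Data.Bool using (Bool; true; false; if_then_else_)
open import Data.Bool.Properties using (if-eta)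
open import Data.Product using (∃₂; _×_; _,_; proj₁; proj₂)
open import Data.Sum using (_⊎_; inj₁; inj₂)
open import Data.List using (List; []; _∷_; _++_; length)
open import Data.List.Properties using (length-++; ++-assoc)
open import Data.Maybe using (Maybe; just; nothing)
open import Data.Maybe.Properties using (just-injective) renaming (≡-dec to ≡-decᴹ)
open import Data.Empty using (⊥-elim)
open import Function using (_∘_; case_of_)
open import Level using (0ℓ)
open import Relation.Nullary using (yes; no; does)
open import Relation.Nullary.Decidable using (dec-true; dec-false)
open import Relation.Binary.Bundles using (Setoid)
open import Relation.Binary.Definitions using (DecidableEquality)
import Relation.Binary.Reasoning.Setoid as SetoidReasoning
import Relation.Binary.PropositionalEquality as ≡
open ≡ using (_≡_; _≢_; refl; subst)

_≟_ : ∀ {n} → DecidableEquality (Maybe (Fin n))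
_≟_ = ≡-decᴹ _≟F_

≡-by-just-tests : ∀ {n} {r s : Maybe (Fin n)} → (∀ e → does (r ≟ just e) ≡ does (s ≟ just e)) → r ≡ s
≡-by-just-tests {r = nothing} {nothing} _ = refl
≡-by-just-tests {r = nothing} {just b}  agree = ≡.sym (≡-by-just-tests (≡.sym ∘ agree))
≡-by-just-tests {r = just a}  {s} agree
  with s ≟ just a | ≡.trans (≡.sym (agree a)) (dec-true (just a ≟ just a) refl)
... | yes s≡a | _  = ≡.sym s≡a
... | no _    | ()

length-<-++-∷ : ∀ {A : Set} (ys : List A) x zs → length zs < length (ys ++ x ∷ zs)
length-<-++-∷ ys x zs rewrite length-++ ys {x ∷ zs} = m≤n+m (suc (length zs)) (length ys)

module _ {S : Set} where
  branch : (S → Bool × S) → (S → Bool × S) → Bool × S → Bool × S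
  branch f g (true  , H) = f H
  branch f g (false , H) = g H

  branch-cong : ∀ {f f′ g g′ r r′} → (∀ H → f H ≡ f′ H) → (∀ H → g H ≡ g′ H) →
                r ≡ r′ → branch f g r ≡ branch f′ g′ r′
  branch-cong {r = true  , H} f≗f′ g≗g′ refl = f≗f′ H
  branch-cong {r = false , H} f≗f′ g≗g′ refl = g≗g′ H

  branch-eta : ∀ f r → branch f f r ≡ f (proj₂ r)
  branch-eta f (true  , H) = refl
  branch-eta f (false , H) = refl

module _ {n : ℕ} (V : RVA n) where
  open RVA V

  run : Term n → RV → Bool × RV
  run P H = _/_ V P H , ∂T V P H

  run-◁▷ : ∀ P Q R H → run (P ◁ Q ▷ R) H ≡ branch (run P) (run R) (run Q H)
  run-◁▷ P Q R H with _/_ V Q H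
  ... | true  = refl
  ... | false = refl

  run-if : ∀ b X₁ X₂ H → branch (run X₁) (run X₂) (b , H) ≡ run (if b then X₁ else X₂) H
  run-if true  X₁ X₂ H = refl
  run-if false X₁ X₂ H = refl

  run-◁▷-cong : ∀ P R {Q Q′ H H′} → run Q H ≡ run Q′ H′ → run (P ◁ Q ▷ R) H ≡ run (P ◁ Q′ ▷ R) H′
  run-◁▷-cong P R {Q} {Q′} {H} {H′} eq = begin
    run (P ◁ Q ▷ R) H                    ≡⟨ run-◁▷ P Q R H ⟩
    branch (run P) (run R) (run Q H)     ≡⟨ ≡.cong (branch (run P) (run R)) eq ⟩
    branch (run P) (run R) (run Q′ H′)   ≡⟨ ≡.sym (run-◁▷ P Q′ R H′) ⟩
    run (P ◁ Q′ ▷ R) H′                  ∎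
    where open ≡.≡-Reasoning

  module _ (cr : InCr V) where
    open InCr cr

    axiom-sound : ∀ {P Q} → Axiom P Q → ∀ H → run P H ≡ run Q H
    axiom-sound (CP1 _ _) H = refl
    axiom-sound (CP2 _ _) H = refl
    axiom-sound (CP3 x) H with _/_ V x H
    ... | true  = refl
    ... | false = refl
    axiom-sound (CP4 _ _ z _ _) H with _/_ V z H
    ... | true  = refl
    ... | false = refl
    axiom-sound (CPcr1 a _ _ _) H rewrite y-∂ a H | ∂-∂ a H with y a H
    ... | true  = refl
    ... | false = refl
    axiom-sound (CPcr2 a _ _ _) H rewrite y-∂ a H | ∂-∂ a H with y a H
    ... | true  = refl
    ... | false = refl

    sound : ∀ {P Q} → n ⊢CPcr P ≈ Q → ∀ H → run P H ≡ run Q H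
    sound (ax α) H = axiom-sound α H
    sound refl H = refl
    sound (sym d) H = ≡.sym (sound d H)
    sound (trans d e) H = ≡.trans (sound d H) (sound e H)
    sound (cong {P} {P′} {Q} {Q′} {R} {R′} dp dq dr) H = begin
      run (P ◁ Q ▷ R) H                     ≡⟨ run-◁▷ P Q R H ⟩
      branch (run P) (run R) (run Q H)      ≡⟨ branch-cong (sound dp) (sound dr) (sound dq H) ⟩
      branch (run P′) (run R′) (run Q′ H)   ≡⟨ ≡.sym (run-◁▷ P′ Q′ R′ H) ⟩
      run (P′ ◁ Q′ ▷ R′) H                  ∎
      where open ≡.≡-Reasoning

⊢-setoid : ℕ → Setoid 0ℓ 0ℓ
⊢-setoid n = record
  { Carrier       = Term n
  ; _≈_           = n ⊢CPcr_≈_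
  ; isEquivalence = record { refl = refl ; sym = sym ; trans = trans }
  }

module BasicForms {n : ℕ} where
  open SetoidReasoning (⊢-setoid n)

  -- Basic forms in which no atom is queried twice in a row; parent is the atom queried
  -- just above the root, if any.
  data BasicForm (parent : Maybe (Fin n)) : Maybe (Fin n) → Term n → Set where
    leafT : BasicForm parent nothing T
    leafF : BasicForm parent nothing F
    node  : ∀ {r s P R} a → parent ≢ just a → BasicForm (just a) r P → BasicForm (just a) s R →
            BasicForm parent (just a) (P ◁ atom a ▷ R)

  record Normal (P : Term n) : Set where
    constructor normal
    field
      root       : Maybe (Fin n)
      term       : Term n
      basic      : BasicForm nothing root term
      derivation : n ⊢CPcr P ≈ term

  inBranch : Fin n → Bool → Term n → Term n → Term n
  inBranch a true  X W = X ◁ atom a ▷ W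
  inBranch a false X W = W ◁ atom a ▷ X

  record Restriction (a : Fin n) (v : Bool) (P : Term n) : Set where
    constructor restriction
    field
      root       : Maybe (Fin n)
      term       : Term n
      basic      : BasicForm (just a) root term
      derivation : ∀ W → n ⊢CPcr inBranch a v P W ≈ inBranch a v term W

  restrict : ∀ a v {p r P} → BasicForm p r P → Restriction a v P
  restrict a v leafT = restriction _ T leafT (λ _ → refl)
  restrict a v leafF = restriction _ F leafF (λ _ → refl)
  restrict a v (node b _ bp br) with b ≟F a
  restrict a true  (node {P = P} {R} a _ bp _) | yes refl =
    restriction _ P bp (λ W → ax (CPcr1 a P R W))
  restrict a false (node {P = P} {R} a _ _ br) | yes refl =
    restriction _ R br (λ W → ax (CPcr2 a W P R))
  ... | no b≢a = restriction _ _ (node b (b≢a ∘ ≡.sym ∘ just-injective) bp br) (λ _ → refl)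

  normalise-◁▷ : ∀ {r s t p X Y B} → BasicForm nothing r X → BasicForm nothing s Y →
                 BasicForm p t B → Normal (X ◁ B ▷ Y)
  normalise-◁▷ bx by leafT = normal _ _ bx (ax (CP1 _ _))
  normalise-◁▷ bx by leafF = normal _ _ by (ax (CP2 _ _))
  normalise-◁▷ {X = X} {Y} bx by (node {P = B₁} {B₂} a _ b₁ b₂)
    with normalise-◁▷ bx by b₁ | normalise-◁▷ bx by b₂
  ... | normal _ Z₁ bz₁ d₁ | normal _ Z₂ bz₂ d₂
    with restrict a true bz₁ | restrict a false bz₂
  ... | restriction _ Z₁′ b₁′ e₁ | restriction _ Z₂′ b₂′ e₂ =
    normal _ _ (node a (λ ()) b₁′ b₂′) (begin
      X ◁ (B₁ ◁ atom a ▷ B₂) ▷ Y                 ≈⟨ ax (CP4 X B₁ (atom a) B₂ Y) ⟩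
      (X ◁ B₁ ▷ Y) ◁ atom a ▷ (X ◁ B₂ ▷ Y)      ≈⟨ cong d₁ refl d₂ ⟩
      Z₁ ◁ atom a ▷ Z₂                          ≈⟨ e₁ Z₂ ⟩
      Z₁′ ◁ atom a ▷ Z₂                         ≈⟨ e₂ Z₁′ ⟩
      Z₁′ ◁ atom a ▷ Z₂′                        ∎)

  normalise : ∀ P → Normal P
  normalise T = normal _ T leafT refl
  normalise F = normal _ F leafF refl
  normalise (atom a) = normal _ (T ◁ atom a ▷ F) (node a (λ ()) leafT leafF) (sym (ax (CP3 _)))
  normalise (P ◁ Q ▷ R) with normalise P | normalise Q | normalise R
  ... | normal _ P′ bp dp | normal _ Q′ bq dq | normal _ R′ br dr with normalise-◁▷ bp br bq
  ... | normal _ Z bz dz = normal _ Z bz (trans (cong dp dq dr) dz)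

module HistoryModel {n : ℕ} where
  History : Set
  History = List (Fin n × Bool)

  Oracle : Set
  Oracle = Fin n → History → Bool

  headAtom : History → Maybe (Fin n)
  headAtom []            = nothing
  headAtom ((a , _) ∷ _) = just a

  -- Junk value on [], which never arises as the result of remember.
  answer : History → Bool
  answer []            = false
  answer ((_ , w) ∷ _) = w

  remember : Fin n → Bool → History → History
  remember a w g with headAtom g ≟ just a
  ... | yes _ = g
  ... | no  _ = (a , w) ∷ g

  remember-at-head : ∀ {a w g} → headAtom g ≡ just a → remember a w g ≡ g
  remember-at-head {a} {w} {g} at-head with headAtom g ≟ just a
  ... | yes _      = refl
  ... | no ¬at-head = ⊥-elim (¬at-head at-head)

  remember-fresh : ∀ {a w g} → headAtom g ≢ just a → remember a w g ≡ (a , w) ∷ g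
  remember-fresh {a} {w} {g} fresh with headAtom g ≟ just a
  ... | yes at-head = ⊥-elim (fresh at-head)
  ... | no _        = refl

  headAtom-remember : ∀ a w g → headAtom (remember a w g) ≡ just a
  headAtom-remember a w g with headAtom g ≟ just a
  ... | yes at-head = at-head
  ... | no _        = refl

  remember-cases : ∀ a w g → remember a w g ≡ g ⊎ remember a w g ≡ (a , w) ∷ g
  remember-cases a w g with headAtom g ≟ just a
  ... | yes _ = inj₁ refl
  ... | no _  = inj₂ refl

  remember-idem : ∀ a w w′ g → remember a w′ (remember a w g) ≡ remember a w g
  remember-idem a w w′ g = remember-at-head (headAtom-remember a w g)

  query : Oracle → Fin n → History → History
  query O a g = remember a (O a g) g

  data State : Set where
    top bot : State
    hs      : History → State

  model : Oracle → RVA n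
  model O = record
    { RV   = State
    ; T-RV = top
    ; F-RV = bot
    ; y    = λ { _ top → true ; _ bot → false ; a (hs g) → answer (query O a g) }
    ; ∂    = λ { a (hs g) → hs (query O a g) ; _ H → H }
    ; y-T  = λ _ → refl
    ; y-F  = λ _ → refl
    ; ∂-T  = λ _ → refl
    ; ∂-F  = λ _ → refl
    }

  model-cr : ∀ O → InCr (model O)
  model-cr O = record { y-∂ = y-∂ ; ∂-∂ = ∂-∂ }
    where
      query-idem : ∀ a g → query O a (query O a g) ≡ query O a g
      query-idem a g = remember-idem a (O a g) _ g

      y-∂ : ∀ a H → RVA.y (model O) a (RVA.∂ (model O) a H) ≡ RVA.y (model O) a H
      y-∂ a top    = refl
      y-∂ a bot    = refl
      y-∂ a (hs g) = ≡.cong answer (query-idem a g)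

      ∂-∂ : ∀ a H → RVA.∂ (model O) a (RVA.∂ (model O) a H) ≡ RVA.∂ (model O) a H
      ∂-∂ a top    = refl
      ∂-∂ a bot    = refl
      ∂-∂ a (hs g) = ≡.cong hs (query-idem a g)

  exec : Oracle → Term n → History → Bool × State
  exec O X g = run (model O) X (hs g)

  Extends : History → Bool × State → Set
  Extends g r = ∃₂ λ b ys → r ≡ (b , hs (ys ++ g))

  extends-++ : ∀ {g} ys {r} → Extends (ys ++ g) r → Extends g r
  extends-++ {g} ys (b , zs , refl) = b , zs ++ ys , ≡.cong (λ g′ → b , hs g′) (≡.sym (++-assoc zs ys g))

  exec-extends : ∀ O X g → Extends g (exec O X g)
  exec-extends O T g = true , [] , refl
  exec-extends O F g = false , [] , refl
  exec-extends O (atom a) g with remember-cases a (O a g) g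
  ... | inj₁ eq = _ , []    , ≡.cong (λ g′ → answer (query O a g) , hs g′) eq
  ... | inj₂ eq = _ , _ ∷ [] , ≡.cong (λ g′ → answer (query O a g) , hs g′) eq
  exec-extends O (P ◁ Q ▷ R) g =
    subst (Extends g) (≡.sym (run-◁▷ (model O) P Q R (hs g))) (continue (exec-extends O Q g))
    where
      continue : ∀ {r} → Extends g r → Extends g (branch (run (model O) P) (run (model O) R) r)
      continue (true  , ys , refl) = extends-++ ys (exec-extends O P (ys ++ g))
      continue (false , ys , refl) = extends-++ ys (exec-extends O R (ys ++ g))

  AgreeFrom : ℕ → Oracle → Oracle → Set
  AgreeFrom m O O′ = ∀ a g → m ≤ length g → O a g ≡ O′ a g

  exec-local : ∀ {m O O′} → AgreeFrom m O O′ → ∀ X g → m ≤ length g → exec O X g ≡ exec O′ X g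
  exec-local agree T g _ = refl
  exec-local agree F g _ = refl
  exec-local agree (atom a) g m≤ =
    ≡.cong (λ w → answer (remember a w g) , hs (remember a w g)) (agree a g m≤)
  exec-local {m} {O} {O′} agree (P ◁ Q ▷ R) g m≤ = begin
    exec O (P ◁ Q ▷ R) g                                   ≡⟨ run-◁▷ (model O) P Q R (hs g) ⟩
    branch (run (model O) P) (run (model O) R) (exec O Q g)   ≡⟨ ≡.cong (branch _ _) (exec-local agree Q g m≤) ⟩
    branch (run (model O) P) (run (model O) R) (exec O′ Q g)  ≡⟨ continue (exec-extends O′ Q g) ⟩
    branch (run (model O′) P) (run (model O′) R) (exec O′ Q g) ≡⟨ ≡.sym (run-◁▷ (model O′) P Q R (hs g)) ⟩
    exec O′ (P ◁ Q ▷ R) g                                  ∎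
    where
      open ≡.≡-Reasoning
      m≤++ : ∀ ys → m ≤ length (ys ++ g)
      m≤++ ys rewrite length-++ ys {g} = ≤-trans m≤ (m≤n+m (length g) (length ys))
      continue : ∀ {r} → Extends g r →
                 branch (run (model O) P) (run (model O) R) r ≡ branch (run (model O′) P) (run (model O′) R) r
      continue (true  , ys , refl) = exec-local agree P (ys ++ g) (m≤++ ys)
      continue (false , ys , refl) = exec-local agree R (ys ++ g) (m≤++ ys)

  exec-fresh-node : ∀ O {a h v} X₁ X₂ → headAtom h ≢ just a → O a h ≡ v →
                    exec O (X₁ ◁ atom a ▷ X₂) h ≡ exec O (if v then X₁ else X₂) ((a , v) ∷ h)
  exec-fresh-node O {a} {h} {v} X₁ X₂ fresh O≡v = begin
    exec O (X₁ ◁ atom a ▷ X₂) h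
      ≡⟨ run-◁▷ (model O) X₁ (atom a) X₂ (hs h) ⟩
    branch (run (model O) X₁) (run (model O) X₂) (answer (query O a h) , hs (query O a h))
      ≡⟨ ≡.cong (λ g → branch (run (model O) X₁) (run (model O) X₂) (answer g , hs g)) (remember-fresh fresh) ⟩
    branch (run (model O) X₁) (run (model O) X₂) (O a h , hs ((a , O a h) ∷ h))
      ≡⟨ ≡.cong (λ w → branch (run (model O) X₁) (run (model O) X₂) (w , hs ((a , w) ∷ h))) O≡v ⟩
    branch (run (model O) X₁) (run (model O) X₂) (v , hs ((a , v) ∷ h))
      ≡⟨ run-if (model O) v X₁ X₂ _ ⟩
    exec O (if v then X₁ else X₂) ((a , v) ∷ h)
      ∎
    where open ≡.≡-Reasoning

  atDepth : ℕ → History → Maybe (Fin n)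
  atDepth m []            = nothing
  atDepth m ((a , _) ∷ g) = if does (length g ≟ℕ m) then just a else atDepth m g

  atDepth-shallow : ∀ {m} g → length g ≤ m → atDepth m g ≡ nothing
  atDepth-shallow []      _ = refl
  atDepth-shallow {m} (_ ∷ g) g<m rewrite dec-false (length g ≟ℕ m) (<⇒≢ g<m) = atDepth-shallow g (<⇒≤ g<m)

  atDepth-entry : ∀ ys a w h → atDepth (length h) (ys ++ (a , w) ∷ h) ≡ just a
  atDepth-entry []      a w h rewrite dec-true (length h ≟ℕ length h) refl = refl
  atDepth-entry (_ ∷ ys) a w h
    rewrite dec-false (length (ys ++ (a , w) ∷ h) ≟ℕ length h)
                      (λ eq → <⇒≢ (length-<-++-∷ ys (a , w) h) (≡.sym eq)) =
    atDepth-entry ys a w h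

  atDepth-remember-shallow : ∀ c w h →
    atDepth (length h) (remember c w h) ≡ nothing ⊎ atDepth (length h) (remember c w h) ≡ just c
  atDepth-remember-shallow c w h with remember-cases c w h
  ... | inj₁ eq = inj₁ (≡.trans (≡.cong (atDepth (length h)) eq) (atDepth-shallow h ≤-refl))
  ... | inj₂ eq = inj₂ (≡.trans (≡.cong (atDepth (length h)) eq) (atDepth-entry [] c w h))

  atDepth-remember-entry : ∀ c w ys a v h → atDepth (length h) (remember c w (ys ++ (a , v) ∷ h)) ≡ just a
  atDepth-remember-entry c w ys a v h with remember-cases c w (ys ++ (a , v) ∷ h)
  ... | inj₁ eq = ≡.trans (≡.cong (atDepth (length h)) eq) (atDepth-entry ys a v h)
  ... | inj₂ eq = ≡.trans (≡.cong (atDepth (length h)) eq) (atDepth-entry ((c , w) ∷ ys) a v h)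

  setDepth : ℕ → Bool → Oracle → Oracle
  setDepth m v O a g = if does (length g ≟ℕ m) then v else O a g

  setDepth-at : ∀ m v O a g → length g ≡ m → setDepth m v O a g ≡ v
  setDepth-at m v O a g at rewrite dec-true (length g ≟ℕ m) at = refl

  setDepth-above : ∀ m v O → AgreeFrom (suc m) (setDepth m v O) O
  setDepth-above m v O a g m<g rewrite dec-false (length g ≟ℕ m) (λ eq → <⇒≢ m<g (≡.sym eq)) = refl

module Completeness {n : ℕ} (other : Fin n → Fin n) (other≢ : ∀ e → other e ≢ e) where
  open BasicForms {n}
  open HistoryModel {n}

  reader : Fin n → Term n
  reader e = atom e ◁ atom (other e) ▷ atom e

  data Observer : Set where
    direct : Observer
    after  : Fin n → Observer

  observe : Observer → Term n → Term n
  observe direct    X = X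
  observe (after e) X = reader e ◁ X ▷ reader e

  observe-run : ∀ (V : RVA n) o {X Y H H′} → run V X H ≡ run V Y H′ →
                run V (observe o X) H ≡ run V (observe o Y) H′
  observe-run V direct    eq = eq
  observe-run V (after e) {X} {Y} {H} {H′} eq = run-◁▷-cong V (reader e) (reader e) {X} {Y} {H} {H′} eq

  observe-⊢ : ∀ o {X Y} → n ⊢CPcr X ≈ Y → n ⊢CPcr observe o X ≈ observe o Y
  observe-⊢ direct    d = d
  observe-⊢ (after e) d = cong refl d refl

  observe-congruence : ∀ {R} → IsCongruence R → ∀ o {X Y} → R X Y → R (observe o X) (observe o Y)
  observe-congruence isCong direct    r = r
  observe-congruence isCong (after e) r = compatible reflexive r reflexive
    where open IsCongruence isCong

  Indistinguishable : History → Term n → Term n → Set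
  Indistinguishable h P Q = ∀ O o → _/_ (model O) (observe o P) (hs h) ≡ _/_ (model O) (observe o Q) (hs h)

  =cr⇒indistinguishable : ∀ {P Q} → P =cr Q → ∀ h → Indistinguishable h P Q
  =cr⇒indistinguishable (R , isCong , R⊆≡cr , P~Q) h O o =
    R⊆≡cr (observe-congruence isCong o P~Q) (model O) (model-cr O) (hs h)

  ⊢⇒indistinguishable : ∀ {P Q} → n ⊢CPcr P ≈ Q → ∀ h → Indistinguishable h P Q
  ⊢⇒indistinguishable d h O o = ≡.cong proj₁ (sound (model O) (model-cr O) (observe-⊢ o d) (hs h))

  reader-reads : ∀ O e g → _/_ (model O) (reader e) (hs g) ≡ O e (query O (other e) g)
  reader-reads O e g = ≡.trans (if-eta (answer (query O (other e) g))) (≡.cong answer (remember-fresh fresh))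
    where
      fresh : headAtom (query O (other e) g) ≢ just e
      fresh eq = other≢ e (just-injective (≡.trans (≡.sym (headAtom-remember (other e) _ g)) eq))

  after-reads : ∀ O e X h {b g} → exec O X h ≡ (b , hs g) →
                _/_ (model O) (observe (after e) X) (hs h) ≡ O e (query O (other e) g)
  after-reads O e X h {b} {g} eq = begin
    proj₁ (run (model O) (reader e ◁ X ▷ reader e) (hs h))
      ≡⟨ ≡.cong proj₁ (run-◁▷ (model O) (reader e) X (reader e) (hs h)) ⟩
    proj₁ (branch (run (model O) (reader e)) (run (model O) (reader e)) (exec O X h))
      ≡⟨ ≡.cong proj₁ (branch-eta _ (exec O X h)) ⟩
    _/_ (model O) (reader e) (proj₂ (exec O X h))
      ≡⟨ ≡.cong (λ r → _/_ (model O) (reader e) (proj₂ r)) eq ⟩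
    _/_ (model O) (reader e) (hs g)
      ≡⟨ reader-reads O e g ⟩
    O e (query O (other e) g)
      ∎
    where open ≡.≡-Reasoning

  probe : ℕ → Fin n → Oracle
  probe m e _ g = does (atDepth m g ≟ just e)

  leaf-probe : ∀ {h b} e X → exec (probe (length h) e) X h ≡ (b , hs h) →
               _/_ (model (probe (length h) e)) (observe (after e) X) (hs h) ≡ false
  leaf-probe {h} e X eq with atDepth-remember-shallow (other e) (probe (length h) e (other e) h) h
  ... | inj₁ nothing-there =
    ≡.trans (after-reads _ e X h eq) (≡.cong (λ r → does (r ≟ just e)) nothing-there)
  ... | inj₂ other-there = begin
    _/_ (model (probe (length h) e)) (observe (after e) X) (hs h)
      ≡⟨ after-reads _ e X h eq ⟩
    does (atDepth (length h) (query (probe (length h) e) (other e) h) ≟ just e)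
      ≡⟨ ≡.cong (λ r → does (r ≟ just e)) other-there ⟩
    does (just (other e) ≟ just e)
      ≡⟨ dec-false (just (other e) ≟ just e) (other≢ e ∘ just-injective) ⟩
    false
      ∎
    where open ≡.≡-Reasoning

  node-probe : ∀ {h a} e P₁ P₂ → headAtom h ≢ just a →
               _/_ (model (probe (length h) e)) (observe (after e) (P₁ ◁ atom a ▷ P₂)) (hs h) ≡ does (just a ≟ just e)
  node-probe {h} {a} e P₁ P₂ fresh = finish (exec-extends O (if O a h then P₁ else P₂) ((a , O a h) ∷ h))
    where
      open ≡.≡-Reasoning
      O = probe (length h) e
      finish : Extends ((a , O a h) ∷ h) (exec O (if O a h then P₁ else P₂) ((a , O a h) ∷ h)) →
               _/_ (model O) (observe (after e) (P₁ ◁ atom a ▷ P₂)) (hs h) ≡ does (just a ≟ just e)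
      finish (b , ys , eq) = begin
        _/_ (model O) (observe (after e) (P₁ ◁ atom a ▷ P₂)) (hs h)
          ≡⟨ after-reads O e (P₁ ◁ atom a ▷ P₂) h (≡.trans (exec-fresh-node O P₁ P₂ fresh refl) eq) ⟩
        does (atDepth (length h) (query O (other e) (ys ++ (a , O a h) ∷ h)) ≟ just e)
          ≡⟨ ≡.cong (λ r → does (r ≟ just e)) (atDepth-remember-entry (other e) _ ys a (O a h) h) ⟩
        does (just a ≟ just e)
          ∎

  root-probe : ∀ {h r P} e → BasicForm (headAtom h) r P →
               _/_ (model (probe (length h) e)) (observe (after e) P) (hs h) ≡ does (r ≟ just e)
  root-probe {h} e leafT = leaf-probe {h} e T refl
  root-probe {h} e leafF = leaf-probe {h} e F refl
  root-probe e (node {P = P₁} {P₂} a fresh _ _) = node-probe e P₁ P₂ fresh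

  same-root : ∀ {h r s P Q} → BasicForm (headAtom h) r P → BasicForm (headAtom h) s Q →
              Indistinguishable h P Q → r ≡ s
  same-root {h} {r} {s} {P} {Q} bp bq ind = ≡-by-just-tests λ e → begin
    does (r ≟ just e)                                                     ≡⟨ ≡.sym (root-probe e bp) ⟩
    _/_ (model (probe (length h) e)) (observe (after e) P) (hs h)         ≡⟨ ind (probe (length h) e) (after e) ⟩
    _/_ (model (probe (length h) e)) (observe (after e) Q) (hs h)         ≡⟨ root-probe e bq ⟩
    does (s ≟ just e)                                                     ∎
    where open ≡.≡-Reasoning

  -- Answering v at depth length h sends O′ into the v-branch, and O′ agrees with O on
  -- all histories that the branch can reach.
  indistinguishable-branch : ∀ {h a P₁ P₂ Q₁ Q₂} v → headAtom h ≢ just a →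
    Indistinguishable h (P₁ ◁ atom a ▷ P₂) (Q₁ ◁ atom a ▷ Q₂) →
    Indistinguishable ((a , v) ∷ h) (if v then P₁ else P₂) (if v then Q₁ else Q₂)
  indistinguishable-branch {h} {a} {P₁} {P₂} {Q₁} {Q₂} v fresh ind O o = begin
    _/_ (model O) (observe o (if v then P₁ else P₂)) (hs ((a , v) ∷ h))   ≡⟨ enter P₁ P₂ ⟩
    _/_ (model O′) (observe o (P₁ ◁ atom a ▷ P₂)) (hs h)                  ≡⟨ ind O′ o ⟩
    _/_ (model O′) (observe o (Q₁ ◁ atom a ▷ Q₂)) (hs h)                  ≡⟨ ≡.sym (enter Q₁ Q₂) ⟩
    _/_ (model O) (observe o (if v then Q₁ else Q₂)) (hs ((a , v) ∷ h))   ∎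
    where
      open ≡.≡-Reasoning
      O′ = setDepth (length h) v O
      enter : ∀ X₁ X₂ → _/_ (model O) (observe o (if v then X₁ else X₂)) (hs ((a , v) ∷ h)) ≡
                        _/_ (model O′) (observe o (X₁ ◁ atom a ▷ X₂)) (hs h)
      enter X₁ X₂ = ≡.cong proj₁ (≡.trans
        (≡.sym (exec-local (setDepth-above (length h) v O) (observe o (if v then X₁ else X₂)) ((a , v) ∷ h) ≤-refl))
        (observe-run (model O′) o (≡.sym (exec-fresh-node O′ X₁ X₂ fresh (setDepth-at (length h) v O a h refl)))))

  basic-unique : ∀ {h r s P Q} → BasicForm (headAtom h) r P → BasicForm (headAtom h) s Q →
                 Indistinguishable h P Q → P ≡ Q
  basic-unique bp bq ind with same-root bp bq ind
  basic-unique leafT leafT ind | refl = refl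
  basic-unique leafF leafF ind | refl = refl
  basic-unique leafT leafF ind | refl = case ind (λ _ _ → true) direct of λ ()
  basic-unique leafF leafT ind | refl = case ind (λ _ _ → true) direct of λ ()
  basic-unique (node a fresh bp₁ bp₂) (node .a _ bq₁ bq₂) ind | refl =
    ≡.cong₂ (λ X Y → X ◁ atom a ▷ Y)
      (basic-unique bp₁ bq₁ (indistinguishable-branch true  fresh ind))
      (basic-unique bp₂ bq₂ (indistinguishable-branch false fresh ind))

  complete : ∀ {P Q} → P =cr Q → n ⊢CPcr P ≈ Q
  complete {P} {Q} P=Q with normalise P | normalise Q
  ... | normal _ P′ bp dp | normal _ Q′ bq dq = begin
    P   ≈⟨ dp ⟩
    P′  ≡⟨ basic-unique bp bq P′≃Q′ ⟩
    Q′  ≈⟨ sym dq ⟩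
    Q   ∎
    where
      open SetoidReasoning (⊢-setoid n)
      P′≃Q′ : Indistinguishable [] P′ Q′
      P′≃Q′ O o = ≡.trans (≡.sym (⊢⇒indistinguishable dp [] O o))
                    (≡.trans (=cr⇒indistinguishable P=Q [] O o) (⊢⇒indistinguishable dq [] O o))

other : ∀ {k} → Fin (suc (suc k)) → Fin (suc (suc k))
other fzero    = fsuc fzero
other (fsuc _) = fzero

other≢ : ∀ {k} (e : Fin (suc (suc k))) → other e ≢ e
other≢ fzero    ()
other≢ (fsuc _) ()

mainTheorem8 : (n : ℕ) → 2 ≤ n → (P Q : Term n) → P =cr Q → n ⊢CPcr P ≈ Q
mainTheorem8 (suc (suc k)) (s≤s (s≤s z≤n)) P Q = Completeness.complete other other≢
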